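{- Let $D\ge0$, $B>0$ and let $G$ be a finite control-flow graph. Then its graph of paths $G^+$ is finite and can be computed in finite time; more precisely, $G^n=G^{n+1}$ for some $n$, and $G^+=G^n$ for this $n$.
   Context: Let $\mathbb{Z}_\infty=\mathbb{Z}\cup\{\infty\}$ (ordered with $\infty$ largest, $\infty+n=n+\infty=\infty+\infty=\infty$). Terms $\mathcal{T}$: generated by $t ::= \mathtt{x} \mid \mathtt{C}\,t \mid (t_1,\dots,t_n) \mid \overline{\mathtt{C}}\,t \mid \pi_i t \mid t_1+t_2 \mid \mathbf{0} \mid \langle w\rangle t$ ($\mathtt{x}$ a variable, $\mathtt{C}$ a constructor, $n\ge0$, $i\ge1$, $w\in\mathbb{Z}_\infty$; $()$ is the empty tuple), quotiented by: every term former ($\mathtt{C}\,\cdot$, $\overline{\mathtt{C}}\,\cdot$, $\pi_i\cdot$, $\langle w\rangle\cdot$, each tuple component) sends $\mathbf{0}$ to $\mathbf{0}$ and distributes over $+$; $+$ is associative, commutative, idempotent with neutral $\mathbf{0}$. $\mathcal{T}(\mathtt{x}_1,\dots,\mathtt{x}_n)$ denotes terms with variables among $\mathtt{x}_1,\dots,\mathtt{x}_n$. Reduction $\to$: contextual closure of $\overline{\mathtt{C}}\,\mathtt{C}\,t\to t$; $\pi_i(t_1,\dots,t_n)\to t_i$ ($1\le i\le n$); $\langle w\rangle\mathtt{C}\,t\to\langle w+1\rangle t$; $\langle w\rangle(t_1,\dots,t_n)\to\sum_{i}\langle w+1\rangle t_i$ ($n>0$); $\overline{\mathtt{C}}\langle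 w\rangle t\to\langle w-1\rangle t$; $\pi_i\langle w\rangle t\to\langle w-1\rangle t$; $\langle w\rangle\langle v\rangle t\to\langle w+v\rangle t$; $\pi_i\,\mathtt{C}\,t\to\mathbf{0}$; $\pi_i(t_1,\dots,t_n)\to\mathbf{0}$ ($i>n$); $\overline{\mathtt{C}}(t_1,\dots,t_n)\to\mathbf{0}$; $\overline{\mathtt{C}}\,\mathtt{D}\,t\to\mathbf{0}$ ($\mathtt{C}\ne\mathtt{D}$). It is strongly normalizing and confluent; $\mathrm{nf}(t)$ is the normal form. Simple terms (normal forms without $+$, $\mathbf{0}$) are generated by $t ::= \mathtt{C}\,t \mid (t_1,\dots,t_n)\,(n>0) \mid \vec d \mid \langle w\rangle\vec d$, where a destructor sequence $\vec d$ is $()$ or $d_1\cdots d_k\mathtt{x}$ with each $d_j$ some $\overline{\mathtt{C}}$ or $\pi_i$, of length $|\vec d|=k$ ($|()|=0$). Substitutions $[\mathtt{x}_1:=u_1;\dots;\mathtt{x}_n:=u_n]$; for $\tau=[\mathtt{x}_i:=u_i]_i$, $\tau\circ\sigma=[\mathtt{x}_i:=u_i\sigma]_i$. Collapsing: $\lceil w\rceil_B=-B$ if $w<-B$, $=w$ if $-B\le w<B$, $=\infty$ if $w\ge B$; on simple terms $\lceil\mathtt{C}\,t\rceil_B=\mathtt{C}\lceil t\rceil_B$, $\lceil(t_1,\dots,t_n)\rceil_B=(\lceil t_i\rceil_B)_i$, $\lceil\langle w\rangle\vec d\rceil_B=\langle\lceil w\rceil_B\rangle\vec d$, $\lceil\vec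 d\rceil_B=\vec d$. Depth collapsing on simple terms, first applicable clause: $\mathrm{cut}_i(\mathtt{C}\,t)=\mathtt{C}\,\mathrm{cut}_{i-1}(t)$ ($i>0$); $\mathrm{cut}_i((t_1,\dots,t_n))=(\mathrm{cut}_{i-1}(t_j))_j$ ($i>0$); $\mathrm{cut}_i(\langle w\rangle\vec d)=\langle w\rangle\mathrm{cut}^D(\vec d)$ ($i>0$); $\mathrm{cut}_i(\vec d)=\mathrm{cut}^D(\vec d)$ ($i>0$); $\mathrm{cut}_0(t)=\mathrm{cut}^D(\mathrm{nf}(\langle0\rangle t))$ (summandwise); $\mathrm{cut}^D(\langle w\rangle\vec d)=\langle w\rangle\mathrm{cut}^D(\vec d)$; $\mathrm{cut}^D(\vec d)=\vec d$ if $|\vec d|\le D$; $\mathrm{cut}^D(\overline{\mathtt{C}}\vec d)=\langle-1\rangle\mathrm{cut}^D(\vec d)$, $\mathrm{cut}^D(\pi_i\vec d)=\langle-1\rangle\mathrm{cut}^D(\vec d)$ when the argument has length $>D$; results in normal form; all extended linearly and via normal forms. Collapsed composition: $\tau\circ_c\sigma$ is pointwise $\lceil\mathrm{cut}_D(\cdot)\rceil_B$ applied to $\tau\circ\sigma$. A control-flow graph is a labeled directed multigraph whose vertices are function names, each with a list of parameter variables; if $\mathtt{f}$ has parameters $\mathtt{y}_1,\dots,\mathtt{y}_m$ and $\mathtt{g}$ has parameters $\mathtt{x}_1,\dots,\mathtt{x}_n$, an arc $\mathtt{f}\to\mathtt{g}$ is labeled by $[\mathtt{x}_1:=u_1;\dots;\mathtt{x}_n:=u_n]$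 with $u_i\in\mathcal{T}(\mathtt{y}_1,\dots,\mathtt{y}_m)$. Graph of paths (for bounds $D,B$): $G^0=G$; the arcs of $G^{n+1}$ from $\mathtt{f}$ to $\mathtt{g}$ are those of $G^n$ together with all $\sigma\circ_c\tau$ where $\tau$ is an arc $\mathtt{f}\to\mathtt{h}$ of $G^n$ and $\sigma$ an arc $\mathtt{h}\to\mathtt{g}$ of $G$, $\mathtt{h}$ any vertex; $G^+=\bigcup_{n\ge0}G^n$ (arcs are identified by their endpoints and labels). -}

module Defs where

open import Data.Nat as ℕ using (ℕ; zero; suc; _≤ᵇ_; _≡ᵇ_; _∸_)
open import Data.Integer as ℤ using (ℤ; +_; -[1+_])
open import Data.Fin using (Fin)
open import Data.Bool using (Bool; true; false; if_then_else_)
open import Data.List using (List; []; _∷_; [_]; map; concatMap; _++_; length; drop)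
open import Data.List.Relation.Unary.Any using (Any)
open import Data.List.Membership.Propositional using (_∈_)
open import Data.Product using (Σ; _×_; _,_)
open import Data.Sum using (_⊎_)
open import Relation.Nullary using (does)
open import Function using (_∘_)

data ℤ∞ : Set where
  fin : ℤ → ℤ∞
  ∞   : ℤ∞

infixl 6 _+∞_
_+∞_ : ℤ∞ → ℤ∞ → ℤ∞
fin a +∞ fin b = fin (a ℤ.+ b)
fin _ +∞ ∞     = ∞
∞     +∞ _     = ∞

one minusOne : ℤ∞
one      = fin (+ 1)
minusOne = fin -[1+ 0 ]

-- A term in T(x₁..xₘ)
-- is represented by the finite set of its (+/0-free) monomials: since
-- every term former distributes over + and sends 0 to 0, and + is ACI
-- with neutral 0, the quotient T is exactly "finite sets of monomials".
-- Finite sets are lists, compared up to having the same elements (_≋_).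

Con : Set
Con = ℕ

data Mono (m : ℕ) : Set where
  var  : Fin m → Mono m
  con  : Con → Mono m → Mono m
  tup  : List (Mono m) → Mono m
  dcon : Con → Mono m → Mono m
  proj : ℕ → Mono m → Mono m          -- proj k t  is  π_{k+1} t
  wt   : ℤ∞ → Mono m → Mono m

Term : ℕ → Set
Term m = List (Mono m)

_≋_ : ∀ {m} → Term m → Term m → Set
t ≋ u = (∀ x → x ∈ t → x ∈ u) × (∀ x → x ∈ u → x ∈ t)

-- Simple terms (normal forms without + and 0)

data Dest : Set where
  dC : Con → Dest
  dπ : ℕ → Dest        -- dπ k is π_{k+1}

-- destructor sequences:  ()  or  d₁ ⋯ dₖ x  (d₁ outermost = head)
data DSeq (m : ℕ) : Set where
  unit  : DSeq m
  chain : List Dest → Fin m → DSeq m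

∣_∣ᵈ : ∀ {m} → DSeq m → ℕ
∣ unit ∣ᵈ      = 0
∣ chain l _ ∣ᵈ = length l

data Simple (m : ℕ) : Set where
  con : Con → Simple m → Simple m
  tup : Simple m → List (Simple m) → Simple m     -- nonempty tuple
  ds  : DSeq m → Simple m
  wds : ℤ∞ → DSeq m → Simple m

embDest : ∀ {m} → Dest → Mono m → Mono m
embDest (dC c) t = dcon c t
embDest (dπ k) t = proj k t

embD : ∀ {m} → DSeq m → Mono m
embD unit          = tup []
embD (chain [] x)  = var x
embD (chain (d ∷ l) x) = embDest d (embD (chain l x))

emb  : ∀ {m} → Simple m → Mono m
embs : ∀ {m} → List (Simple m) → List (Mono m)
emb (con c t)  = con c (emb t)
emb (tup s ss) = tup (emb s ∷ embs ss)
emb (ds d)     = embD d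
emb (wds w d)  = wt w (embD d)
embs []       = []
embs (s ∷ ss) = emb s ∷ embs ss

lookupL : ∀ {A : Set} → ℕ → List A → List A
lookupL k       []       = []
lookupL zero    (x ∷ xs) = [ x ]
lookupL (suc k) (x ∷ xs) = lookupL k xs

dconS : ∀ {m} → Con → Simple m → List (Simple m)
dconS c (con c' u)        = if c ≡ᵇ c' then [ u ] else []
dconS c (tup _ _)         = []
dconS c (ds unit)         = []
dconS c (ds (chain l x))  = [ ds (chain (dC c ∷ l) x) ]
dconS c (wds w d)         = [ wds (w +∞ minusOne) d ]

projS : ∀ {m} → ℕ → Simple m → List (Simple m)
projS k (con _ _)         = []
projS k (tup s ss)        = lookupL k (s ∷ ss)
projS k (ds unit)         = []
projS k (ds (chain l x))  = [ ds (chain (dπ k ∷ l) x) ]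
projS k (wds w d)         = [ wds (w +∞ minusOne) d ]

wtS  : ∀ {m} → ℤ∞ → Simple m → List (ℤ∞ × DSeq m)
wtSs : ∀ {m} → ℤ∞ → List (Simple m) → List (ℤ∞ × DSeq m)
wtS w (con c u)  = wtS (w +∞ one) u
wtS w (tup s ss) = wtS (w +∞ one) s ++ wtSs (w +∞ one) ss
wtS w (ds d)     = [ (w , d) ]
wtS w (wds v d)  = [ (w +∞ v , d) ]
wtSs w []       = []
wtSs w (s ∷ ss) = wtS w s ++ wtSs w ss

nfW : ∀ {m} → ℤ∞ → Simple m → List (Simple m)
nfW w s = map (λ { (v , d) → wds v d }) (wtS w s)

tuples : ∀ {m} → List (Simple m) → List (List (Simple m)) → List (Simple m)
tuples ss sss = concatMap (λ s → map (tup s) sss) ss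

nf     : ∀ {m} → Mono m → List (Simple m)
nfComb : ∀ {m} → List (Mono m) → List (List (Simple m))
nf (var x)    = [ ds (chain [] x) ]
nf (con c t)  = map (con c) (nf t)
nf (tup [])   = [ ds unit ]
nf (tup (t ∷ ts)) = tuples (nf t) (nfComb ts)
nf (dcon c t) = concatMap (dconS c) (nf t)
nf (proj k t) = concatMap (projS k) (nf t)
nf (wt w t)   = concatMap (λ { (v , d) → [ wds v d ] }) (concatMap (wtS w) (nf t))
nfComb []       = [ [] ]
nfComb (t ∷ ts) = concatMap (λ s → map (s ∷_) (nfComb ts)) (nf t)

nfT : ∀ {m} → Term m → List (Simple m)
nfT = concatMap nf

cutᴰL : ∀ {m} → ℕ → List Dest → Fin m → List (Simple m)
cutᴰL D []      x = [ ds (chain [] x) ]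
cutᴰL D (d ∷ l) x =
  if suc (length l) ≤ᵇ D then [ ds (chain (d ∷ l) x) ]
  else concatMap (nfW minusOne) (cutᴰL D l x)

cutᴰ : ∀ {m} → ℕ → DSeq m → List (Simple m)
cutᴰ D unit        = [ ds unit ]
cutᴰ D (chain l x) = cutᴰL D l x

cutT  : ∀ {m} → ℕ → ℕ → Simple m → List (Simple m)
cutTs : ∀ {m} → ℕ → ℕ → List (Simple m) → List (List (Simple m))
cutT D zero t =
  concatMap (λ { (w , d) → concatMap (nfW w) (cutᴰ D d) }) (wtS (fin (+ 0)) t)
cutT D (suc i) (con c t)  = map (con c) (cutT D i t)
cutT D (suc i) (tup s ss) = tuples (cutT D i s) (cutTs D i ss)
cutT D (suc i) (ds d)     = cutᴰ D d
cutT D (suc i) (wds w d)  = concatMap (nfW w) (cutᴰ D d)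
cutTs D i []       = [ [] ]
cutTs D i (s ∷ ss) = concatMap (λ u → map (u ∷_) (cutTs D i ss)) (cutT D i s)

clampW : ℕ → ℤ∞ → ℤ∞
clampW B ∞ = ∞
clampW B (fin z) =
  if does (z ℤ.<? ℤ.- (+ B)) then fin (ℤ.- (+ B))
  else if does (z ℤ.<? + B) then fin z
  else ∞

collapse  : ∀ {m} → ℕ → Simple m → Simple m
collapses : ∀ {m} → ℕ → List (Simple m) → List (Simple m)
collapse B (con c t)  = con c (collapse B t)
collapse B (tup s ss) = tup (collapse B s) (collapses B ss)
collapse B (ds d)     = ds d
collapse B (wds w d)  = wds (clampW B w) d
collapses B []       = []
collapses B (s ∷ ss) = collapse B s ∷ collapses B ss

Subst : ℕ → ℕ → Set
Subst n m = Fin n → Term m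

_≈ˢ_ : ∀ {n m} → Subst n m → Subst n m → Set
σ ≈ˢ τ = ∀ i → σ i ≋ τ i

substM    : ∀ {m k} → Subst m k → Mono m → Term k
substComb : ∀ {m k} → Subst m k → List (Mono m) → List (List (Mono k))
substM σ (var x)    = σ x
substM σ (con c t)  = map (con c) (substM σ t)
substM σ (tup ts)   = map tup (substComb σ ts)
substM σ (dcon c t) = map (dcon c) (substM σ t)
substM σ (proj k t) = map (proj k) (substM σ t)
substM σ (wt w t)   = map (wt w) (substM σ t)
substComb σ []       = [ [] ]
substComb σ (t ∷ ts) = concatMap (λ u → map (u ∷_) (substComb σ ts)) (substM σ t)

substT : ∀ {m k} → Subst m k → Term m → Term k
substT σ = concatMap (substM σ)

_∘ˢ_ : ∀ {n m k} → Subst n m → Subst m k → Subst n k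
(τ ∘ˢ σ) i = substT σ (τ i)

compc : ∀ {n m k} → ℕ → ℕ → Subst n m → Subst m k → Subst n k
compc D B τ σ i =
  embs (collapses B (concatMap (cutT D D) (nfT ((τ ∘ˢ σ) i))))

record CFG : Set where
  field
    V    : ℕ
    ar   : Fin V → ℕ
    arcs : (f g : Fin V) → List (Subst (ar g) (ar f))

open CFG public

-- the graph of paths Gⁿ (for bounds D, B), as a predicate on labelled
-- arcs f → g, arcs being identified by endpoints and labels (in T)
Gⁿ : (G : CFG) (D B : ℕ) → ℕ → (f g : Fin (V G)) → Subst (ar G g) (ar G f) → Set
Gⁿ G D B zero    f g σ = Any (σ ≈ˢ_) (arcs G f g)
Gⁿ G D B (suc n) f g σ =
  Gⁿ G D B n f g σ ⊎
  Σ (Fin (V G)) λ h → Σ (Subst (ar G h) (ar G f)) λ τ →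
    Gⁿ G D B n f h τ × Any (λ ρ → σ ≈ˢ compc D B ρ τ) (arcs G h g)

G⁺ : (G : CFG) (D B : ℕ) → (f g : Fin (V G)) → Subst (ar G g) (ar G f) → Set
G⁺ G D B f g σ = Σ ℕ λ n → Gⁿ G D B n f g σ

_⇔_ : Set → Set → Set
A ⇔ B = (A → B) × (B → A)

-- Collapsing keeps every label produced by a composition small: cut_D bounds the depth of the
-- constructor/tuple context and the length of destructor sequences by D, ⌈·⌉_B confines weights
-- to the finite set {-B, …, B-1, ∞}, and constructor names, projection indices and tuple widths
-- stay below a bound K read off from the labels of G.  So, up to equality in T, the labels of
-- composed arcs range over a finite set of substitutions, and the increasing sequence
-- G⁰ ⊆ G¹ ⊆ ⋯ must become constant: as long as it does not, the number of those finitely many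
-- labels present in Gⁿ grows.
module Submission where

open import Defs
open import Data.Nat using (ℕ; _<_; suc)
open import Data.Fin using (Fin)
open import Data.List using (List)
open import Data.List.Relation.Unary.Any using (Any)
open import Data.Product using (Σ; _×_)

open import Data.Nat as ℕ using (zero; _≤_; _+_; z≤n; s≤s)
open import Data.Nat.Properties
  using (≤-trans; ≤-reflexive; <⇒≤; <-irrefl; <-≤-trans; m≤n⇒m≤1+n; m≤m+n; m+n≤o⇒m≤o; m+n≤o⇒n≤o;
         ≮⇒≥; ≤ᵇ⇒≤; +-suc; +-monoʳ-≤)
open import Data.Integer as ℤ using (+_; -[1+_])
import Data.Integer.Properties as ℤ
import Data.Fin.Properties as Fin
open import Data.Bool using (true; false; T)
open import Data.Unit using (⊤; tt)
open import Data.Empty using (⊥; ⊥-elim)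
open import Data.Product using (_,_; proj₁; proj₂; swap; ∃₂; ∃-syntax)
open import Data.Sum using (inj₁; inj₂)
open import Data.List
  using ([]; _∷_; [_]; map; concatMap; _++_; length; upTo; allFin; filter;
         cartesianProductWith; cartesianProduct)
open import Data.List.Properties using (length-map; length-filter)
open import Data.List.Extrema.Nat using (max; xs≤max)
open import Data.List.Relation.Unary.Any as Any using (here; there; any?)
import Data.List.Relation.Unary.Any.Properties as Any
open import Data.List.Relation.Unary.All as All using (All; []; _∷_)
open import Data.List.Membership.Propositional using (_∈_; lose; find)
open import Data.List.Membership.Propositional.Properties
  using (∈-map⁺; ∈-map⁻; ∈-++⁺ˡ; ∈-++⁺ʳ; ∈-++⁻; ∈-concatMap⁺; ∈-concatMap⁻; ∈-allFin; ∈-upTo⁺;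
         ∈-filter⁺; ∈-filter⁻; ∈-cartesianProductWith⁺; ∈-cartesianProductWith⁻;
         ∈-cartesianProduct⁺)
open import Data.List.Relation.Binary.Subset.Propositional using (_⊆_)
open import Data.List.Relation.Binary.Subset.Propositional.Properties
  using (map⁺; concatMap⁺; ⊆-trans; ⊆-reflexive)
open import Function using (_∘_)
open import Relation.Binary.PropositionalEquality using (_≡_; refl; sym; trans; cong; subst)
open import Relation.Binary.Definitions using (DecidableEquality)
open import Relation.Nullary using (¬_; Dec; yes; no; ¬?; does)
open import Relation.Nullary.Decidable using (map′; _×-dec_; decidable-stable)
open import Relation.Unary using (Decidable; U)

private variable
  A B C : Set
  m n k : ℕ

∈-concatMap⁺′ : (f : A → List B) {xs : List A} {x : A} {y : B} →
                x ∈ xs → y ∈ f x → y ∈ concatMap f xs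
∈-concatMap⁺′ f x∈ y∈ = ∈-concatMap⁺ f (lose x∈ y∈)

∈-concatMap⁻′ : (f : A → List B) (xs : List A) {y : B} →
                y ∈ concatMap f xs → ∃[ x ] x ∈ xs × y ∈ f x
∈-concatMap⁻′ f xs y∈ = find (∈-concatMap⁻ f y∈)

concatMap-map≡cartesianProductWith : (g : A → B → C) (xs : List A) (ys : List B) →
  concatMap (λ x → map (g x) ys) xs ≡ cartesianProductWith g xs ys
concatMap-map≡cartesianProductWith g []       ys = refl
concatMap-map≡cartesianProductWith g (x ∷ xs) ys =
  cong (map (g x) ys ++_) (concatMap-map≡cartesianProductWith g xs ys)

∈-concatMap-map⁺ : (g : A → B → C) {xs : List A} {ys : List B} {a : A} {b : B} →
                   a ∈ xs → b ∈ ys → g a b ∈ concatMap (λ x → map (g x) ys) xs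
∈-concatMap-map⁺ g {xs} {ys} a∈ b∈ =
  subst (g _ _ ∈_) (sym (concatMap-map≡cartesianProductWith g xs ys))
    (∈-cartesianProductWith⁺ g a∈ b∈)

∈-concatMap-map⁻ : (g : A → B → C) (xs : List A) (ys : List B) {c : C} →
                   c ∈ concatMap (λ x → map (g x) ys) xs → ∃₂ λ a b → a ∈ xs × b ∈ ys × c ≡ g a b
∈-concatMap-map⁻ g xs ys c∈ =
  ∈-cartesianProductWith⁻ g xs ys (subst (_ ∈_) (concatMap-map≡cartesianProductWith g xs ys) c∈)

concatMap-⊆ : {f g : A → List B} {xs ys : List A} →
              xs ⊆ ys → (∀ {x} → f x ⊆ g x) → concatMap f xs ⊆ concatMap g ys
concatMap-⊆ {f = f} {g} {xs} xs⊆ys f⊆g y∈ with x , x∈ , y∈fx ← ∈-concatMap⁻′ f xs y∈ =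
  ∈-concatMap⁺′ g (xs⊆ys x∈) (f⊆g y∈fx)

∈-lookupL : ∀ i (xs : List A) {y} → y ∈ lookupL i xs → y ∈ xs
∈-lookupL zero    (x ∷ xs) (here refl) = here refl
∈-lookupL (suc i) (x ∷ xs) y∈         = there (∈-lookupL i xs y∈)

listsUpTo : ℕ → List A → List (List A)
listsUpTo zero    xs = [ [] ]
listsUpTo (suc n) xs = [] ∷ concatMap (λ x → map (x ∷_) (listsUpTo n xs)) xs

∈-listsUpTo : ∀ n (xs l : List A) → length l ≤ n → All (_∈ xs) l → l ∈ listsUpTo n xs
∈-listsUpTo zero    xs []      _         _         = here refl
∈-listsUpTo (suc n) xs []      _         _         = here refl
∈-listsUpTo (suc n) xs (y ∷ l) (s≤s l≤n) (y∈ ∷ l⊆) =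
  there (∈-concatMap-map⁺ _∷_ y∈ (∈-listsUpTo n xs l l≤n l⊆))

sublists : List A → List (List A)
sublists []       = [ [] ]
sublists (x ∷ xs) = map (x ∷_) (sublists xs) ++ sublists xs

filter-∈-sublists : {P : A → Set} (P? : Decidable P) (xs : List A) → filter P? xs ∈ sublists xs
filter-∈-sublists P? []       = here refl
filter-∈-sublists P? (x ∷ xs) with does (P? x)
... | true  = ∈-++⁺ˡ (∈-map⁺ (x ∷_) (filter-∈-sublists P? xs))
... | false = ∈-++⁺ʳ (map (x ∷_) (sublists xs)) (filter-∈-sublists P? xs)

module _ {P Q : A → Set} (P? : Decidable P) (Q? : Decidable Q) (P⇒Q : ∀ {x} → P x → Q x) where

  length-filter-mono : ∀ xs → length (filter P? xs) ≤ length (filter Q? xs)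
  length-filter-mono []       = z≤n
  length-filter-mono (x ∷ xs) with P? x | Q? x
  ... | yes _  | yes _  = s≤s (length-filter-mono xs)
  ... | yes px | no ¬qx = ⊥-elim (¬qx (P⇒Q px))
  ... | no _   | yes _  = m≤n⇒m≤1+n (length-filter-mono xs)
  ... | no _   | no _   = length-filter-mono xs

  length-filter-strict : ∀ {y} xs → y ∈ xs → Q y → ¬ P y →
                         length (filter P? xs) < length (filter Q? xs)
  length-filter-strict (x ∷ xs) (here refl) qx ¬px with P? x | Q? x
  ... | yes px | _      = ⊥-elim (¬px px)
  ... | no _   | no ¬qx = ⊥-elim (¬qx qx)
  ... | no _   | yes _  = s≤s (length-filter-mono xs)
  length-filter-strict (x ∷ xs) (there y∈) qy ¬py with P? x | Q? x
  ... | yes _  | yes _  = s≤s (length-filter-strict xs y∈ qy ¬py)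
  ... | yes px | no ¬qx = ⊥-elim (¬qx (P⇒Q px))
  ... | no _   | yes _  = m≤n⇒m≤1+n (length-filter-strict xs y∈ qy ¬py)
  ... | no _   | no _   = length-filter-strict xs y∈ qy ¬py

-- While the chain is not stable, the number of elements of xs satisfying P k grows with k.
ascending-chain-stabilises : {P : ℕ → A → Set} → (∀ k → Decidable (P k)) →
  (∀ {k x} → P k x → P (suc k) x) →
  (xs : List A) → ∃[ n ] (∀ {x} → x ∈ xs → P (suc n) x → P n x)
ascending-chain-stabilises {P = P} P? P-step xs = search (length xs) 0 (m≤m+n (length xs) _)
  where
  count : ℕ → ℕ
  count k = length (filter (P? k) xs)

  grows : ∀ k → Any (λ x → P (suc k) x × ¬ P k x) xs → count k < count (suc k)
  grows k new with y , y∈ , py , ¬py ← find new =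
    length-filter-strict (P? k) (P? (suc k)) P-step xs y∈ py ¬py

  search : ∀ fuel k → length xs ≤ fuel + count k → ∃[ n ] (∀ {x} → x ∈ xs → P (suc n) x → P n x)
  search fuel k bound with any? (λ x → P? (suc k) x ×-dec ¬? (P? k x)) xs
  ... | no none = k , λ x∈ px → decidable-stable (P? k _) (λ ¬px → none (lose x∈ (px , ¬px)))
  search zero       k bound | yes new =
    ⊥-elim (<-irrefl refl (<-≤-trans (grows k new) (≤-trans (length-filter (P? (suc k)) xs) bound)))
  search (suc fuel) k bound | yes new = search fuel (suc k)
    (≤-trans bound (≤-trans (≤-reflexive (sym (+-suc fuel (count k))))
                            (+-monoʳ-≤ fuel (grows k new))))

_≟ℤ∞_ : DecidableEquality ℤ∞
fin a ≟ℤ∞ fin b = map′ (cong fin) (λ { refl → refl }) (a ℤ.≟ b)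
fin _ ≟ℤ∞ ∞     = no λ ()
∞     ≟ℤ∞ fin _ = no λ ()
∞     ≟ℤ∞ ∞     = yes refl

-- Comparing constructor indices first lets the coverage checker discard all mixed cases.
constructorIndex : Mono m → ℕ
constructorIndex (var _)    = 0
constructorIndex (con _ _)  = 1
constructorIndex (tup _)    = 2
constructorIndex (dcon _ _) = 3
constructorIndex (proj _ _) = 4
constructorIndex (wt _ _)   = 5

_≟ᴹ_  : DecidableEquality (Mono m)
_≟ᴹˢ_ : DecidableEquality (List (Mono m))
s ≟ᴹ t with constructorIndex s ℕ.≟ constructorIndex t
... | no ≢ = no (≢ ∘ cong constructorIndex)
var x    ≟ᴹ var y    | yes refl = map′ (cong var) (λ { refl → refl }) (x Fin.≟ y)
tup ss   ≟ᴹ tup ts   | yes refl = map′ (cong tup) (λ { refl → refl }) (ss ≟ᴹˢ ts)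
con c s  ≟ᴹ con d t  | yes refl =
  map′ (λ { (refl , refl) → refl }) (λ { refl → refl , refl }) (c ℕ.≟ d ×-dec s ≟ᴹ t)
dcon c s ≟ᴹ dcon d t | yes refl =
  map′ (λ { (refl , refl) → refl }) (λ { refl → refl , refl }) (c ℕ.≟ d ×-dec s ≟ᴹ t)
proj i s ≟ᴹ proj j t | yes refl =
  map′ (λ { (refl , refl) → refl }) (λ { refl → refl , refl }) (i ℕ.≟ j ×-dec s ≟ᴹ t)
wt v s   ≟ᴹ wt w t   | yes refl =
  map′ (λ { (refl , refl) → refl }) (λ { refl → refl , refl }) (v ≟ℤ∞ w ×-dec s ≟ᴹ t)
[]       ≟ᴹˢ []       = yes refl
[]       ≟ᴹˢ (_ ∷ _)  = no λ ()
(_ ∷ _)  ≟ᴹˢ []       = no λ ()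
(s ∷ ss) ≟ᴹˢ (t ∷ ts) =
  map′ (λ { (refl , refl) → refl }) (λ { refl → refl , refl }) (s ≟ᴹ t ×-dec ss ≟ᴹˢ ts)

module MonoDec {m : ℕ} where
  open import Data.List.Membership.DecPropositional (_≟ᴹ_ {m}) public using (_∈?_)
  open import Data.List.Relation.Binary.Subset.DecPropositional (_≟ᴹ_ {m}) public using (_⊆?_)
open MonoDec

_≋?_ : (t u : Term m) → Dec (t ≋ u)
t ≋? u = map′ fromSubsets toSubsets (t ⊆? u ×-dec u ⊆? t)
  where
  fromSubsets : t ⊆ u × u ⊆ t → t ≋ u
  fromSubsets (t⊆u , u⊆t) = (λ _ → t⊆u) , (λ _ → u⊆t)
  toSubsets : t ≋ u → t ⊆ u × u ⊆ t
  toSubsets (t⊆u , u⊆t) = t⊆u _ , u⊆t _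

_≈ˢ?_ : (σ τ : Subst n m) → Dec (σ ≈ˢ τ)
σ ≈ˢ? τ = Fin.all? λ i → σ i ≋? τ i

≈ˢ-refl : {σ : Subst n m} → σ ≈ˢ σ
≈ˢ-refl i = (λ _ x∈ → x∈) , (λ _ x∈ → x∈)

≈ˢ-sym : {σ τ : Subst n m} → σ ≈ˢ τ → τ ≈ˢ σ
≈ˢ-sym σ≈τ i = swap (σ≈τ i)

≈ˢ-trans : {σ τ ρ : Subst n m} → σ ≈ˢ τ → τ ≈ˢ ρ → σ ≈ˢ ρ
≈ˢ-trans σ≈τ τ≈ρ i = (λ x → proj₁ (τ≈ρ i) x ∘ proj₁ (σ≈τ i) x)
                   , (λ x → proj₂ (σ≈τ i) x ∘ proj₂ (τ≈ρ i) x)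

infix 4 _∈ˢ_
_∈ˢ_ : Subst n m → List (Subst n m) → Set
σ ∈ˢ σs = Any (σ ≈ˢ_) σs

∈⇒∈ˢ : {σ : Subst n m} {σs : List (Subst n m)} → σ ∈ σs → σ ∈ˢ σs
∈⇒∈ˢ σ∈ = lose σ∈ ≈ˢ-refl

∈ˢ-resp-≈ˢ : {σ τ : Subst n m} {σs : List (Subst n m)} → σ ≈ˢ τ → τ ∈ˢ σs → σ ∈ˢ σs
∈ˢ-resp-≈ˢ σ≈τ = Any.map (≈ˢ-trans σ≈τ)

-- A substitution σ whose entries lie in M is recovered, up to ≈ˢ, from its graph, the list of
-- pairs (i , x) with x ∈ σ i, which is a sublist of Fin n × M.
fromGraph : List (Fin n × Mono m) → Subst n m
fromGraph g i = map proj₂ (filter ((Fin._≟ i) ∘ proj₁) g)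

substsOver : ∀ n → List (Mono m) → List (Subst n m)
substsOver n M = map fromGraph (sublists (cartesianProduct (allFin n) M))

∈ˢ-substsOver : (M : List (Mono m)) (σ : Subst n m) → (∀ i → σ i ⊆ M) → σ ∈ˢ substsOver n M
∈ˢ-substsOver {n = n} M σ σ⊆M = lose (∈-map⁺ fromGraph (filter-∈-sublists inGraph pairs)) σ≈graph
  where
  pairs : List (Fin n × Mono _)
  pairs = cartesianProduct (allFin n) M

  inGraph : Decidable (λ ((i , x) : Fin n × _) → x ∈ σ i)
  inGraph (i , x) = x ∈? σ i

  σ≈graph : σ ≈ˢ fromGraph (filter inGraph pairs)
  σ≈graph i = to , from
    where
    at-i : Decidable (λ ((j , _) : Fin n × Mono _) → j ≡ i)
    at-i = (Fin._≟ i) ∘ proj₁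
    to : ∀ x → x ∈ σ i → x ∈ fromGraph (filter inGraph pairs) i
    to x x∈ =
      let p∈pairs = ∈-cartesianProduct⁺ (∈-allFin i) (σ⊆M i x∈) in
      ∈-map⁺ proj₂ (∈-filter⁺ at-i (∈-filter⁺ inGraph p∈pairs x∈) refl)
    from : ∀ x → x ∈ fromGraph (filter inGraph pairs) i → x ∈ σ i
    from x x∈
      with (j , y) , p∈ , refl ← ∈-map⁻ proj₂ x∈
      with p∈′ , refl ← ∈-filter⁻ at-i {xs = filter inGraph pairs} p∈ =
      proj₂ (∈-filter⁻ inGraph {xs = pairs} p∈′)

embs≡map : (ss : List (Simple m)) → embs ss ≡ map emb ss
embs≡map []       = refl
embs≡map (s ∷ ss) = cong (emb s ∷_) (embs≡map ss)

collapses≡map : ∀ B (ss : List (Simple m)) → collapses B ss ≡ map (collapse B) ss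
collapses≡map B []       = refl
collapses≡map B (s ∷ ss) = cong (collapse B s ∷_) (collapses≡map B ss)

compc≡ : ∀ D B (ρ : Subst n m) (τ : Subst m k) i →
         compc D B ρ τ i ≡ map emb (map (collapse B) (concatMap (cutT D D) (nfT ((ρ ∘ˢ τ) i))))
compc≡ D B ρ τ i = trans (embs≡map _) (cong (map emb) (collapses≡map B _))

module _ {σ τ : Subst m k} (σ⊆τ : ∀ i → σ i ⊆ τ i) where

  substM-⊆    : (t : Mono m) → substM σ t ⊆ substM τ t
  substComb-⊆ : (ts : List (Mono m)) → substComb σ ts ⊆ substComb τ ts
  substM-⊆ (var i)    = σ⊆τ i
  substM-⊆ (con c t)  = map⁺ (con c) (substM-⊆ t)
  substM-⊆ (tup ts)   = map⁺ tup (substComb-⊆ ts)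
  substM-⊆ (dcon c t) = map⁺ (dcon c) (substM-⊆ t)
  substM-⊆ (proj i t) = map⁺ (proj i) (substM-⊆ t)
  substM-⊆ (wt w t)   = map⁺ (wt w) (substM-⊆ t)
  substComb-⊆ []       us∈ = us∈
  substComb-⊆ (t ∷ ts)     = concatMap-⊆ (substM-⊆ t) (map⁺ _ (substComb-⊆ ts))

  substT-⊆ : (t : Term m) → substT σ t ⊆ substT τ t
  substT-⊆ t = concatMap-⊆ {xs = t} (λ x∈ → x∈) (λ {r} → substM-⊆ r)

compc-⊆ : ∀ D B (ρ : Subst n m) {σ τ : Subst m k} → (∀ j → σ j ⊆ τ j) →
          ∀ i → compc D B ρ σ i ⊆ compc D B ρ τ i
compc-⊆ D B ρ {σ} {τ} σ⊆τ i =
  ⊆-trans (⊆-reflexive (compc≡ D B ρ σ i)) (⊆-trans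
    (map⁺ emb (map⁺ (collapse B) (concatMap⁺ (cutT D D) nfT-⊆)))
    (⊆-reflexive (sym (compc≡ D B ρ τ i))))
  where
  nfT-⊆ : nfT ((ρ ∘ˢ σ) i) ⊆ nfT ((ρ ∘ˢ τ) i)
  nfT-⊆ = concatMap⁺ {xs = substT σ (ρ i)} {ys = substT τ (ρ i)} nf
            (substT-⊆ σ⊆τ (ρ i))

compc-cong : ∀ D B (ρ : Subst n m) {σ τ : Subst m k} → σ ≈ˢ τ → compc D B ρ σ ≈ˢ compc D B ρ τ
compc-cong D B ρ σ≈τ i = (λ x → compc-⊆ D B ρ (λ j {y} → proj₁ (σ≈τ j) y) i)
                       , (λ x → compc-⊆ D B ρ (λ j {y} → proj₂ (σ≈τ j) y) i)

-- Bounded labels and shallow simple terms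

labelSum  : Mono m → ℕ
labelSums : List (Mono m) → ℕ
labelSum (var _)    = 0
labelSum (con c t)  = c + labelSum t
labelSum (tup ts)   = length ts + labelSums ts
labelSum (dcon c t) = c + labelSum t
labelSum (proj i t) = i + labelSum t
labelSum (wt _ t)   = labelSum t
labelSums []       = 0
labelSums (t ∷ ts) = labelSum t + labelSums ts

module LabelBound (K : ℕ) where

  BoundedDest : Dest → Set
  BoundedDest (dC c) = c ≤ K
  BoundedDest (dπ i) = i ≤ K

  BoundedMono  : Mono m → Set
  BoundedMonos : List (Mono m) → Set
  BoundedMono (var _)    = ⊤
  BoundedMono (con c t)  = c ≤ K × BoundedMono t
  BoundedMono (tup ts)   = length ts ≤ K × BoundedMonos ts
  BoundedMono (dcon c t) = c ≤ K × BoundedMono t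
  BoundedMono (proj i t) = i ≤ K × BoundedMono t
  BoundedMono (wt _ t)   = BoundedMono t
  BoundedMonos []       = ⊤
  BoundedMonos (t ∷ ts) = BoundedMono t × BoundedMonos ts

  BoundedSubst : Subst n m → Set
  BoundedSubst σ = ∀ i {x} → x ∈ σ i → BoundedMono x

  labelSum≤⇒bounded  : (t : Mono m) → labelSum t ≤ K → BoundedMono t
  labelSums≤⇒bounded : (ts : List (Mono m)) → labelSums ts ≤ K → BoundedMonos ts
  labelSum≤⇒bounded (var _)    _ = tt
  labelSum≤⇒bounded (con c t)  ≤K = m+n≤o⇒m≤o c ≤K , labelSum≤⇒bounded t (m+n≤o⇒n≤o c ≤K)
  labelSum≤⇒bounded (tup ts)   ≤K =
    m+n≤o⇒m≤o (length ts) ≤K , labelSums≤⇒bounded ts (m+n≤o⇒n≤o (length ts) ≤K)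
  labelSum≤⇒bounded (dcon c t) ≤K = m+n≤o⇒m≤o c ≤K , labelSum≤⇒bounded t (m+n≤o⇒n≤o c ≤K)
  labelSum≤⇒bounded (proj i t) ≤K = m+n≤o⇒m≤o i ≤K , labelSum≤⇒bounded t (m+n≤o⇒n≤o i ≤K)
  labelSum≤⇒bounded (wt _ t)   ≤K = labelSum≤⇒bounded t ≤K
  labelSums≤⇒bounded []       _  = tt
  labelSums≤⇒bounded (t ∷ ts) ≤K =
    labelSum≤⇒bounded t (m+n≤o⇒m≤o (labelSum t) ≤K)
    , labelSums≤⇒bounded ts (m+n≤o⇒n≤o (labelSum t) ≤K)

  module _ {σ : Subst m k} (σ-bounded : BoundedSubst σ) where

    substM-bounded    : (t : Mono m) → BoundedMono t → ∀ {x} → x ∈ substM σ t → BoundedMono x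
    substComb-bounded : (ts : List (Mono m)) → BoundedMonos ts →
                        ∀ {us} → us ∈ substComb σ ts → BoundedMonos us × length us ≡ length ts
    substM-bounded (var i) _ x∈ = σ-bounded i x∈
    substM-bounded (con c t) (c≤ , bt) x∈ with _ , y∈ , refl ← ∈-map⁻ (con c) x∈ =
      c≤ , substM-bounded t bt y∈
    substM-bounded (tup ts) (len≤ , bts) x∈ with us , us∈ , refl ← ∈-map⁻ tup x∈ =
      let bus , len≡ = substComb-bounded ts bts us∈ in subst (_≤ K) (sym len≡) len≤ , bus
    substM-bounded (dcon c t) (c≤ , bt) x∈ with _ , y∈ , refl ← ∈-map⁻ (dcon c) x∈ =
      c≤ , substM-bounded t bt y∈
    substM-bounded (proj i t) (i≤ , bt) x∈ with _ , y∈ , refl ← ∈-map⁻ (proj i) x∈ =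
      i≤ , substM-bounded t bt y∈
    substM-bounded (wt w t) bt x∈ with _ , y∈ , refl ← ∈-map⁻ (wt w) x∈ =
      substM-bounded t bt y∈
    substComb-bounded [] _ (here refl) = tt , refl
    substComb-bounded (t ∷ ts) (bt , bts) us∈
      with u , us , u∈ , us∈ , refl ← ∈-concatMap-map⁻ _∷_ (substM σ t) (substComb σ ts) us∈ =
      let bus , len≡ = substComb-bounded ts bts us∈ in (substM-bounded t bt u∈ , bus) , cong suc len≡

  BoundedDSeq : DSeq m → Set
  BoundedDSeq unit        = ⊤
  BoundedDSeq (chain l _) = All BoundedDest l

  BoundedSimple  : Simple m → Set
  BoundedSimples : List (Simple m) → Set
  BoundedSimple (con c t)  = c ≤ K × BoundedSimple t
  BoundedSimple (tup s ss) = suc (length ss) ≤ K × BoundedSimple s × BoundedSimples ss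
  BoundedSimple (ds d)     = BoundedDSeq d
  BoundedSimple (wds _ d)  = BoundedDSeq d
  BoundedSimples []       = ⊤
  BoundedSimples (s ∷ ss) = BoundedSimple s × BoundedSimples ss

  BoundedSimples-∈ : {ss : List (Simple m)} → BoundedSimples ss → ∀ {s} → s ∈ ss → BoundedSimple s
  BoundedSimples-∈ (bs , _)   (here refl) = bs
  BoundedSimples-∈ (_ , bss) (there s∈)  = BoundedSimples-∈ bss s∈

  dconS-bounded : ∀ c → c ≤ K → (s : Simple m) → BoundedSimple s →
                  ∀ {y} → y ∈ dconS c s → BoundedSimple y
  dconS-bounded c c≤ (con c′ u) (_ , bu) y∈ with c ℕ.≡ᵇ c′
  dconS-bounded c c≤ (con c′ u) (_ , bu) (here refl) | true = bu
  dconS-bounded c c≤ (ds (chain l x)) bl (here refl) = c≤ ∷ bl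
  dconS-bounded c c≤ (wds w d)        bd (here refl) = bd

  projS-bounded : ∀ i → i ≤ K → (s : Simple m) → BoundedSimple s →
                  ∀ {y} → y ∈ projS i s → BoundedSimple y
  projS-bounded i i≤ (tup s ss) (_ , bs , bss) y∈ =
    BoundedSimples-∈ {ss = s ∷ ss} (bs , bss) (∈-lookupL i (s ∷ ss) y∈)
  projS-bounded i i≤ (ds (chain l x)) bl (here refl) = i≤ ∷ bl
  projS-bounded i i≤ (wds w d)        bd (here refl) = bd

  wtS-bounded  : ∀ w (s : Simple m) → BoundedSimple s → ∀ {v d} → (v , d) ∈ wtS w s → BoundedDSeq d
  wtSs-bounded : ∀ w (ss : List (Simple m)) → BoundedSimples ss →
                 ∀ {v d} → (v , d) ∈ wtSs w ss → BoundedDSeq d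
  wtS-bounded w (con c u) (_ , bu) vd∈ = wtS-bounded _ u bu vd∈
  wtS-bounded w (tup s ss) (_ , bs , bss) vd∈ with ∈-++⁻ (wtS (w +∞ one) s) vd∈
  ... | inj₁ vd∈s  = wtS-bounded _ s bs vd∈s
  ... | inj₂ vd∈ss = wtSs-bounded _ ss bss vd∈ss
  wtS-bounded w (ds d)    bd (here refl) = bd
  wtS-bounded w (wds v d) bd (here refl) = bd
  wtSs-bounded w (s ∷ ss) (bs , bss) vd∈ with ∈-++⁻ (wtS w s) vd∈
  ... | inj₁ vd∈s  = wtS-bounded w s bs vd∈s
  ... | inj₂ vd∈ss = wtSs-bounded w ss bss vd∈ss

  embD-bounded : (d : DSeq m) → BoundedDSeq d → BoundedMono (embD d)
  embD-bounded unit                 _          = z≤n , tt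
  embD-bounded (chain [] x)         _          = tt
  embD-bounded (chain (dC c ∷ l) x) (c≤ ∷ bl) = c≤ , embD-bounded (chain l x) bl
  embD-bounded (chain (dπ i ∷ l) x) (i≤ ∷ bl) = i≤ , embD-bounded (chain l x) bl

  nf-bounded     : (t : Mono m) → BoundedMono t → ∀ {s} → s ∈ nf t → BoundedSimple s
  nfComb-bounded : (ts : List (Mono m)) → BoundedMonos ts →
                   ∀ {ss} → ss ∈ nfComb ts → BoundedSimples ss × length ss ≡ length ts
  nf-bounded (var x) _ (here refl) = [] 
  nf-bounded (con c t) (c≤ , bt) s∈ with _ , u∈ , refl ← ∈-map⁻ (con c) s∈ =
    c≤ , nf-bounded t bt u∈
  nf-bounded (tup [])       _ (here refl) = tt
  nf-bounded (tup (t ∷ ts)) (len≤ , bt , bts) s∈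
    with u , us , u∈ , us∈ , refl ← ∈-concatMap-map⁻ tup (nf t) (nfComb ts) s∈ =
    let bus , len≡ = nfComb-bounded ts bts us∈ in
    subst (λ l → suc l ≤ K) (sym len≡) len≤ , nf-bounded t bt u∈ , bus
  nf-bounded (dcon c t) (c≤ , bt) s∈ with u , u∈ , s∈u ← ∈-concatMap⁻′ (dconS c) (nf t) s∈ =
    dconS-bounded c c≤ u (nf-bounded t bt u∈) s∈u
  nf-bounded (proj i t) (i≤ , bt) s∈ with u , u∈ , s∈u ← ∈-concatMap⁻′ (projS i) (nf t) s∈ =
    projS-bounded i i≤ u (nf-bounded t bt u∈) s∈u
  nf-bounded (wt w t) bt s∈
    with (v , d) , vd∈ , here refl ← ∈-concatMap⁻′ _ (concatMap (wtS w) (nf t)) s∈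
    with u , u∈ , vd∈u ← ∈-concatMap⁻′ (wtS w) (nf t) vd∈ =
    wtS-bounded w u (nf-bounded t bt u∈) vd∈u
  nfComb-bounded [] _ (here refl) = tt , refl
  nfComb-bounded (t ∷ ts) (bt , bts) ss∈
    with u , us , u∈ , us∈ , refl ← ∈-concatMap-map⁻ _∷_ (nf t) (nfComb ts) ss∈ =
    let bus , len≡ = nfComb-bounded ts bts us∈ in (nf-bounded t bt u∈ , bus) , cong suc len≡

weights : ℕ → List ℤ∞
weights B = ∞ ∷ fin (ℤ.- (+ B)) ∷ map (fin ∘ +_) (upTo B) ++ map (λ n → fin -[1+ n ]) (upTo B)

fin-∈-weights : ∀ B z → ¬ z ℤ.< ℤ.- (+ B) → z ℤ.< + B → fin z ∈ weights B
fin-∈-weights B       (+ n)    _    n<B =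
  there (there (∈-++⁺ˡ (∈-map⁺ _ (∈-upTo⁺ (ℤ.drop‿+<+ n<B)))))
fin-∈-weights zero    -[1+ n ] z≮-B _   = ⊥-elim (z≮-B ℤ.-<+)
fin-∈-weights (suc B) -[1+ n ] z≮-B _   =
  there (there (∈-++⁺ʳ (map (fin ∘ +_) (upTo (suc B)))
    (∈-map⁺ (λ n → fin -[1+ n ]) (∈-upTo⁺ (s≤s (≮⇒≥ (z≮-B ∘ ℤ.-<-)))))))

clampW-∈-weights : ∀ B w → clampW B w ∈ weights B
clampW-∈-weights B ∞ = here refl
clampW-∈-weights B (fin z) with z ℤ.<? ℤ.- (+ B)
... | yes _ = there (here refl)
... | no z≮-B with z ℤ.<? + B
...   | yes z<B = fin-∈-weights B z z≮-B z<B
...   | no _    = here refl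

module Shallow (K D : ℕ) where
  open LabelBound K

  ShortDSeq : DSeq m → Set
  ShortDSeq unit        = ⊤
  ShortDSeq (chain l _) = length l ≤ D × All BoundedDest l

  -- The shape of the results of cut_i (with W = U) and of ⌈cut_i(·)⌉_B (with W = (_∈ weights B)).
  Shallow  : (ℤ∞ → Set) → ℕ → Simple m → Set
  Shallows : (ℤ∞ → Set) → ℕ → List (Simple m) → Set
  Shallow W i       (ds d)     = ShortDSeq d
  Shallow W i       (wds w d)  = W w × ShortDSeq d
  Shallow W zero    (con _ _)  = ⊥
  Shallow W zero    (tup _ _)  = ⊥
  Shallow W (suc i) (con c t)  = c ≤ K × Shallow W i t
  Shallow W (suc i) (tup s ss) = suc (length ss) ≤ K × Shallow W i s × Shallows W i ss
  Shallows W i []       = ⊤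
  Shallows W i (s ∷ ss) = Shallow W i s × Shallows W i ss

  Shallow-zero⇒Shallow : ∀ {W} i (s : Simple m) → Shallow W 0 s → Shallow W i s
  Shallow-zero⇒Shallow i (ds _)    sh = sh
  Shallow-zero⇒Shallow i (wds _ _) sh = sh

  nfW-shallow : ∀ {W} w (s : Simple m) → Shallow W 0 s → ∀ {y} → y ∈ nfW w s → Shallow U 0 y
  nfW-shallow w (ds d)    sh       (here refl) = tt , sh
  nfW-shallow w (wds v d) (_ , sh) (here refl) = tt , sh

  cutᴰL-shallow : (l : List Dest) (x : Fin m) → All BoundedDest l →
                  ∀ {y} → y ∈ cutᴰL D l x → Shallow U 0 y
  cutᴰL-shallow []      x _ (here refl) = z≤n , []
  cutᴰL-shallow (d ∷ l) x bl y∈ with suc (length l) ℕ.≤ᵇ D in fits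
  cutᴰL-shallow (d ∷ l) x bl (here refl) | true =
    ≤ᵇ⇒≤ (suc (length l)) D (subst T (sym fits) tt) , bl
  ... | false with u , u∈ , y∈u ← ∈-concatMap⁻′ (nfW minusOne) (cutᴰL D l x) y∈ =
    nfW-shallow minusOne u (cutᴰL-shallow l x (All.tail bl) u∈) y∈u

  cutᴰ-shallow : (d : DSeq m) → BoundedDSeq d → ∀ {y} → y ∈ cutᴰ D d → Shallow U 0 y
  cutᴰ-shallow unit        _  (here refl) = tt
  cutᴰ-shallow (chain l x) bl y∈          = cutᴰL-shallow l x bl y∈

  cutᴰ-nfW-shallow : ∀ w (d : DSeq m) → BoundedDSeq d →
                     ∀ {y} → y ∈ concatMap (nfW w) (cutᴰ D d) → Shallow U 0 y
  cutᴰ-nfW-shallow w d bd y∈ with u , u∈ , y∈u ← ∈-concatMap⁻′ (nfW w) (cutᴰ D d) y∈ =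
    nfW-shallow w u (cutᴰ-shallow d bd u∈) y∈u

  cutT-shallow  : ∀ i (s : Simple m) → BoundedSimple s → ∀ {y} → y ∈ cutT D i s → Shallow U i y
  cutTs-shallow : ∀ i (ss : List (Simple m)) → BoundedSimples ss →
                  ∀ {ys} → ys ∈ cutTs D i ss → Shallows U i ys × length ys ≡ length ss
  cutT-shallow zero s bs y∈ with (w , d) , wd∈ , y∈wd ← ∈-concatMap⁻′ _ (wtS (fin (+ 0)) s) y∈ =
    cutᴰ-nfW-shallow w d (wtS-bounded _ s bs wd∈) y∈wd
  cutT-shallow (suc i) (con c t) (c≤ , bt) y∈ with _ , u∈ , refl ← ∈-map⁻ (con c) y∈ =
    c≤ , cutT-shallow i t bt u∈
  cutT-shallow (suc i) (tup s ss) (len≤ , bs , bss) y∈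
    with u , us , u∈ , us∈ , refl ← ∈-concatMap-map⁻ tup (cutT D i s) (cutTs D i ss) y∈ =
    let shus , len≡ = cutTs-shallow i ss bss us∈ in
    subst (λ l → suc l ≤ K) (sym len≡) len≤ , cutT-shallow i s bs u∈ , shus
  cutT-shallow (suc i) (ds d) bd {y} y∈ =
    Shallow-zero⇒Shallow (suc i) y (cutᴰ-shallow d bd y∈)
  cutT-shallow (suc i) (wds w d) bd {y} y∈ =
    Shallow-zero⇒Shallow (suc i) y (cutᴰ-nfW-shallow w d bd y∈)
  cutTs-shallow i [] _ (here refl) = tt , refl
  cutTs-shallow i (s ∷ ss) (bs , bss) ys∈
    with u , us , u∈ , us∈ , refl ← ∈-concatMap-map⁻ _∷_ (cutT D i s) (cutTs D i ss) ys∈ =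
    let shus , len≡ = cutTs-shallow i ss bss us∈ in (cutT-shallow i s bs u∈ , shus) , cong suc len≡

  ShortDSeq⇒Bounded : (d : DSeq m) → ShortDSeq d → BoundedDSeq d
  ShortDSeq⇒Bounded unit        _        = tt
  ShortDSeq⇒Bounded (chain _ _) (_ , bl) = bl

  emb-bounded  : ∀ {W} i (s : Simple m) → Shallow W i s → BoundedMono (emb s)
  embs-bounded : ∀ {W} i (ss : List (Simple m)) → Shallows W i ss → BoundedMonos (embs ss)
  emb-bounded i       (ds d)     sh       = embD-bounded d (ShortDSeq⇒Bounded d sh)
  emb-bounded i       (wds w d)  (_ , sh) = embD-bounded d (ShortDSeq⇒Bounded d sh)
  emb-bounded (suc i) (con c t)  (c≤ , sh) = c≤ , emb-bounded i t sh
  emb-bounded (suc i) (tup s ss) (len≤ , sh , shs) =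
    subst (λ l → suc l ≤ K) (sym (trans (cong length (embs≡map ss)) (length-map emb ss))) len≤
    , emb-bounded i s sh , embs-bounded i ss shs
  embs-bounded i []       _          = tt
  embs-bounded i (s ∷ ss) (sh , shs) = emb-bounded i s sh , embs-bounded i ss shs

  collapse-shallow  : ∀ B i (s : Simple m) → Shallow U i s → Shallow (_∈ weights B) i (collapse B s)
  collapses-shallow : ∀ B i (ss : List (Simple m)) → Shallows U i ss →
                      Shallows (_∈ weights B) i (collapses B ss)
  collapse-shallow B i       (ds d)     sh       = sh
  collapse-shallow B i       (wds w d)  (_ , sh) = clampW-∈-weights B w , sh
  collapse-shallow B (suc i) (con c t)  (c≤ , sh) = c≤ , collapse-shallow B i t sh
  collapse-shallow B (suc i) (tup s ss) (len≤ , sh , shs) =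
    subst (λ l → suc l ≤ K)
      (sym (trans (cong length (collapses≡map B ss)) (length-map (collapse B) ss))) len≤
    , collapse-shallow B i s sh , collapses-shallow B i ss shs
  collapses-shallow B i []       _          = tt
  collapses-shallow B i (s ∷ ss) (sh , shs) = collapse-shallow B i s sh , collapses-shallow B i ss shs

  compc-shallow : ∀ B {ρ : Subst n m} {τ : Subst m k} → BoundedSubst ρ → BoundedSubst τ →
                  ∀ i {x} → x ∈ compc D B ρ τ i → ∃[ s ] Shallow (_∈ weights B) D s × x ≡ emb s
  compc-shallow B {ρ} {τ} ρ-bounded τ-bounded i x∈
    with s , s∈ , refl ← ∈-map⁻ emb (subst (_ ∈_) (compc≡ D B ρ τ i) x∈)
    with y , y∈ , refl ← ∈-map⁻ (collapse B) s∈
    with u , u∈ , y∈u ← ∈-concatMap⁻′ (cutT D D) (nfT ((ρ ∘ˢ τ) i)) y∈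
    with t , t∈ , u∈t ← ∈-concatMap⁻′ nf ((ρ ∘ˢ τ) i) u∈
    with r , r∈ , t∈r ← ∈-concatMap⁻′ (substM τ) (ρ i) t∈ =
    let t-bounded = substM-bounded τ-bounded r (ρ-bounded i r∈) t∈r in
    collapse B y , collapse-shallow B D y (cutT-shallow D u (nf-bounded t t-bounded u∈t) y∈u) , refl

  compc-bounded : ∀ B {ρ : Subst n m} {τ : Subst m k} → BoundedSubst ρ → BoundedSubst τ →
                  BoundedSubst (compc D B ρ τ)
  compc-bounded B ρ-bounded τ-bounded i x∈
    with s , sh , refl ← compc-shallow B ρ-bounded τ-bounded i x∈ = emb-bounded D s sh

-- Finitely many collapsed labels

module Enumeration (K D B : ℕ) where
  open LabelBound K
  open Shallow K D

  dests : List Dest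
  dests = map dC (upTo (suc K)) ++ map dπ (upTo (suc K))

  ∈-dests : ∀ {d} → BoundedDest d → d ∈ dests
  ∈-dests {dC c} c≤ = ∈-++⁺ˡ (∈-map⁺ dC (∈-upTo⁺ (s≤s c≤)))
  ∈-dests {dπ i} i≤ = ∈-++⁺ʳ (map dC (upTo (suc K))) (∈-map⁺ dπ (∈-upTo⁺ (s≤s i≤)))

  dseqs : List (DSeq m)
  dseqs {m} = unit ∷ concatMap (λ l → map (chain l) (allFin m)) (listsUpTo D dests)

  ∈-dseqs : (d : DSeq m) → ShortDSeq d → d ∈ dseqs
  ∈-dseqs unit        _           = here refl
  ∈-dseqs (chain l x) (len≤ , bl) =
    there (∈-concatMap-map⁺ chain (∈-listsUpTo D dests l len≤ (All.map ∈-dests bl)) (∈-allFin x))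

  flatSimples : List (Simple m)
  flatSimples = map ds dseqs ++ concatMap (λ w → map (wds w) dseqs) (weights B)

  simples : ℕ → List (Simple m)
  simples zero    = flatSimples
  simples (suc i) = flatSimples
                 ++ concatMap (λ c → map (con c) (simples i)) (upTo (suc K))
                 ++ concatMap (λ s → map (tup s) (listsUpTo K (simples i))) (simples i)

  flatSimples⊆simples : ∀ i → flatSimples {m} ⊆ simples i
  flatSimples⊆simples zero    s∈ = s∈
  flatSimples⊆simples (suc i) s∈ = ∈-++⁺ˡ s∈

  ∈-simples  : ∀ i (s : Simple m) → Shallow (_∈ weights B) i s → s ∈ simples i
  ∈-simples′ : ∀ i (ss : List (Simple m)) → Shallows (_∈ weights B) i ss → All (_∈ simples i) ss
  ∈-simples i (ds d) sh = flatSimples⊆simples i (∈-++⁺ˡ (∈-map⁺ ds (∈-dseqs d sh)))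
  ∈-simples i (wds w d) (w∈ , sh) =
    flatSimples⊆simples i (∈-++⁺ʳ (map ds dseqs) (∈-concatMap-map⁺ wds w∈ (∈-dseqs d sh)))
  ∈-simples (suc i) (con c t) (c≤ , sh) =
    ∈-++⁺ʳ flatSimples
      (∈-++⁺ˡ (∈-concatMap-map⁺ con (∈-upTo⁺ (s≤s c≤)) (∈-simples i t sh)))
  ∈-simples (suc i) (tup s ss) (len≤ , sh , shs) =
    ∈-++⁺ʳ flatSimples (∈-++⁺ʳ (concatMap (λ c → map (con c) (simples i)) (upTo (suc K)))
      (∈-concatMap-map⁺ tup (∈-simples i s sh)
        (∈-listsUpTo K (simples i) ss (<⇒≤ len≤) (∈-simples′ i ss shs))))
  ∈-simples′ i []       _          = []
  ∈-simples′ i (s ∷ ss) (sh , shs) = ∈-simples i s sh ∷ ∈-simples′ i ss shs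

  monos : List (Mono m)
  monos = map emb (simples D)

  compc-⊆-monos : {ρ : Subst n m} {τ : Subst m k} → BoundedSubst ρ → BoundedSubst τ →
                  ∀ i → compc D B ρ τ i ⊆ monos
  compc-⊆-monos ρ-bounded τ-bounded i x∈
    with s , sh , refl ← compc-shallow B ρ-bounded τ-bounded i x∈ = ∈-map⁺ emb (∈-simples D s sh)

Stable : CFG → (D B n : ℕ) → Set
Stable G D B n = ∀ f g σ → Gⁿ G D B (suc n) f g σ → Gⁿ G D B n f g σ

stable⇒G⁺⊆Gⁿ : ∀ {G D B n} → Stable G D B n →
               ∀ f g σ → G⁺ G D B f g σ → Gⁿ G D B n f g σ
stable⇒G⁺⊆Gⁿ {G} {D} {B} {n} stable f g σ (m , σ∈Gᵐ) = Gᵐ⊆Gⁿ m f g σ σ∈Gᵐ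
  where
  G⁰⊆Gʲ : ∀ j f g σ → Gⁿ G D B 0 f g σ → Gⁿ G D B j f g σ
  G⁰⊆Gʲ zero    f g σ σ∈G⁰ = σ∈G⁰
  G⁰⊆Gʲ (suc j) f g σ σ∈G⁰ = inj₁ (G⁰⊆Gʲ j f g σ σ∈G⁰)

  Gᵐ⊆Gⁿ : ∀ m f g σ → Gⁿ G D B m f g σ → Gⁿ G D B n f g σ
  Gᵐ⊆Gⁿ zero    f g σ σ∈G⁰        = G⁰⊆Gʲ n f g σ σ∈G⁰
  Gᵐ⊆Gⁿ (suc m) f g σ (inj₁ σ∈Gᵐ) = Gᵐ⊆Gⁿ m f g σ σ∈Gᵐ
  Gᵐ⊆Gⁿ (suc m) f g σ (inj₂ (h , τ , τ∈Gᵐ , σ∈arcs)) =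
    stable f g σ (inj₂ (h , τ , Gᵐ⊆Gⁿ m f h τ τ∈Gᵐ , σ∈arcs))

module PathGraph (D B : ℕ) (G : CFG) where

  vertices : List (Fin (V G))
  vertices = allFin (V G)

  K : ℕ
  K = max 0 (concatMap (λ f → concatMap (λ g → concatMap (λ ρ →
        concatMap (λ i → map labelSum (ρ i)) (allFin (ar G g))) (arcs G f g)) vertices) vertices)

  open LabelBound K
  open Shallow K D using (compc-bounded)
  open Enumeration K D B using (monos; compc-⊆-monos)

  arc-bounded : ∀ {f g ρ} → ρ ∈ arcs G f g → BoundedSubst ρ
  arc-bounded {f} {g} {ρ} ρ∈ i {x} x∈ = labelSum≤⇒bounded x (All.lookup (xs≤max 0 _)
    (∈-concatMap⁺′ _ (∈-allFin f) (∈-concatMap⁺′ _ (∈-allFin g) (∈-concatMap⁺′ _ ρ∈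
      (∈-concatMap⁺′ (λ i → map labelSum (ρ i)) (∈-allFin i) (∈-map⁺ labelSum x∈))))))

  paths      : ℕ → (f g : Fin (V G)) → List (Subst (ar G g) (ar G f))
  extensions : ℕ → (f g : Fin (V G)) → List (Subst (ar G g) (ar G f))
  paths zero    f g = arcs G f g
  paths (suc n) f g = paths n f g ++ extensions n f g
  extensions n f g =
    concatMap (λ h → concatMap (λ τ → map (λ ρ → compc D B ρ τ) (arcs G h g)) (paths n f h))
      vertices

  ∈-extensions⁺ : ∀ n {f g h τ ρ} → τ ∈ paths n f h → ρ ∈ arcs G h g →
                  compc D B ρ τ ∈ extensions n f g
  ∈-extensions⁺ n {h = h} τ∈ ρ∈ =
    ∈-concatMap⁺′ _ (∈-allFin h) (∈-concatMap-map⁺ (λ τ ρ → compc D B ρ τ) τ∈ ρ∈)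

  ∈-extensions⁻ : ∀ n {f g σ} → σ ∈ extensions n f g →
    ∃[ h ] ∃₂ λ τ ρ → τ ∈ paths n f h × ρ ∈ arcs G h g × σ ≡ compc D B ρ τ
  ∈-extensions⁻ n {f} {g} σ∈ with h , _ , σ∈h ← ∈-concatMap⁻′ _ vertices σ∈ =
    h , ∈-concatMap-map⁻ (λ τ ρ → compc D B ρ τ) (paths n f h) (arcs G h g) σ∈h

  paths-bounded : ∀ n {f g σ} → σ ∈ paths n f g → BoundedSubst σ
  paths-bounded zero          σ∈ = arc-bounded σ∈
  paths-bounded (suc n) {f} {g} σ∈ with ∈-++⁻ (paths n f g) σ∈
  ... | inj₁ σ∈paths = paths-bounded n σ∈paths
  ... | inj₂ σ∈ext with _ , _ , _ , τ∈ , ρ∈ , refl ← ∈-extensions⁻ n σ∈ext =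
    compc-bounded B (arc-bounded ρ∈) (paths-bounded n τ∈)

  Gⁿ⇔∈ˢpaths : ∀ n f g σ → Gⁿ G D B n f g σ ⇔ (σ ∈ˢ paths n f g)
  Gⁿ⇔∈ˢpaths zero    f g σ = (λ σ∈ → σ∈) , (λ σ∈ → σ∈)
  Gⁿ⇔∈ˢpaths (suc n) f g σ = to , from
    where
    to : Gⁿ G D B (suc n) f g σ → σ ∈ˢ paths (suc n) f g
    to (inj₁ σ∈Gⁿ) = Any.++⁺ˡ (proj₁ (Gⁿ⇔∈ˢpaths n f g σ) σ∈Gⁿ)
    to (inj₂ (h , τ , τ∈Gⁿ , σ∈ˢarcs))
      with τ′ , τ′∈ , τ≈τ′ ← find (proj₁ (Gⁿ⇔∈ˢpaths n f h τ) τ∈Gⁿ)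
      with ρ , ρ∈ , σ≈ρτ ← find σ∈ˢarcs =
      Any.++⁺ʳ (paths n f g)
        (lose (∈-extensions⁺ n τ′∈ ρ∈) (≈ˢ-trans σ≈ρτ (compc-cong D B ρ τ≈τ′)))
    from : σ ∈ˢ paths (suc n) f g → Gⁿ G D B (suc n) f g σ
    from σ∈ˢ with Any.++⁻ (paths n f g) σ∈ˢ
    ... | inj₁ σ∈ˢpaths = inj₁ (proj₂ (Gⁿ⇔∈ˢpaths n f g σ) σ∈ˢpaths)
    ... | inj₂ σ∈ˢext
      with σ′ , σ′∈ , σ≈σ′ ← find σ∈ˢext
      with h , τ , ρ , τ∈ , ρ∈ , refl ← ∈-extensions⁻ n σ′∈ =
      inj₂ (h , τ , proj₂ (Gⁿ⇔∈ˢpaths n f h τ) (∈⇒∈ˢ τ∈) , lose ρ∈ σ≈σ′)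

  Label : Set
  Label = Σ (Fin (V G)) λ f → Σ (Fin (V G)) λ g → Subst (ar G g) (ar G f)

  labels : List Label
  labels = concatMap (λ f → concatMap (λ g → map (λ σ → f , g , σ) (substsOver (ar G g) monos))
             vertices) vertices

  OnPath : ℕ → Label → Set
  OnPath n (f , g , σ) = σ ∈ˢ paths n f g

  OnPath? : ∀ n → Decidable (OnPath n)
  OnPath? n (f , g , σ) = any? (σ ≈ˢ?_) (paths n f g)

  extension-∈ˢ-labels : ∀ n {f g σ} → σ ∈ extensions n f g →
                        ∃[ u ] (f , g , u) ∈ labels × σ ≈ˢ u
  extension-∈ˢ-labels n {f} {g} σ∈ with _ , τ , ρ , τ∈ , ρ∈ , refl ← ∈-extensions⁻ n σ∈
    with u , u∈ , σ≈u ← find (∈ˢ-substsOver monos (compc D B ρ τ)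
                                 (compc-⊆-monos (arc-bounded ρ∈) (paths-bounded n τ∈))) =
    u , ∈-concatMap⁺′ _ (∈-allFin f) (∈-concatMap⁺′ _ (∈-allFin g) (∈-map⁺ _ u∈))
      , σ≈u

  paths-stabilise : ∃[ n ] Stable G D B n
  paths-stabilise with n , stable ← ascending-chain-stabilises OnPath? Any.++⁺ˡ labels = n , stableGⁿ
    where
    -- A new label σ′ of paths (suc n) is ≈ˢ some u in labels, and stability at u brings it
    -- into paths n.
    stable-paths : ∀ {f g σ} → σ ∈ˢ paths (suc n) f g → σ ∈ˢ paths n f g
    stable-paths {f} {g} σ∈ˢ
      with σ′ , σ′∈ , σ≈σ′ ← find σ∈ˢ
      with ∈-++⁻ (paths n f g) σ′∈
    ... | inj₁ σ′∈paths = lose σ′∈paths σ≈σ′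
    ... | inj₂ σ′∈ext with u , u∈ , σ′≈u ← extension-∈ˢ-labels n σ′∈ext =
      ∈ˢ-resp-≈ˢ (≈ˢ-trans σ≈σ′ σ′≈u) (stable u∈ (lose σ′∈ (≈ˢ-sym σ′≈u)))

    stableGⁿ : Stable G D B n
    stableGⁿ f g σ =
      proj₂ (Gⁿ⇔∈ˢpaths n f g σ) ∘ stable-paths ∘ proj₁ (Gⁿ⇔∈ˢpaths (suc n) f g σ)

lemma2p3 : (D B : ℕ) → 0 < B → (G : CFG) →
    Σ ℕ λ n →
      (∀ f g σ → Gⁿ G D B (suc n) f g σ ⇔ Gⁿ G D B n f g σ)
      × (∀ f g σ → G⁺ G D B f g σ ⇔ Gⁿ G D B n f g σ)
      × Σ ((f g : Fin (V G)) → List (Subst (ar G g) (ar G f))) λ L →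
          ∀ f g σ → G⁺ G D B f g σ ⇔ Any (σ ≈ˢ_) (L f g)
lemma2p3 D B _ G with n , stable ← PathGraph.paths-stabilise D B G =
  n , (λ f g σ → stable f g σ , inj₁)
    , (λ f g σ → G⁺⊆Gⁿ f g σ , (n ,_))
    , paths n
    , λ f g σ → proj₁ (Gⁿ⇔∈ˢpaths n f g σ) ∘ G⁺⊆Gⁿ f g σ
              , (n ,_) ∘ proj₂ (Gⁿ⇔∈ˢpaths n f g σ)
  where
  open PathGraph D B G using (paths; Gⁿ⇔∈ˢpaths)
  G⁺⊆Gⁿ : ∀ f g σ → G⁺ G D B f g σ → Gⁿ G D B n f g σ
  G⁺⊆Gⁿ = stable⇒G⁺⊆Gⁿ stable
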